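{- For every integer $k\ge 0$, the iterated balanced star $S_{k+1}$ is tournament anti-Sidorenko.
   Context: All digraphs are oriented graphs (no loops, no antiparallel edges). A tournament is an orientation of a complete graph without loops. $t_D(T)=h_D(T)/v(T)^{v(D)}$ where $h_D(T)$ is the number of maps $\phi:V(D)\to V(T)$ with $(\phi(x),\phi(y))\in E(T)$ for every $(x,y)\in E(D)$; $D$ is tournament anti-Sidorenko if $t_D(T)\le2^{ -e(D)}$ for every tournament $T$. Iterated balanced stars are defined recursively: $S_0$ is the empty digraph, and for $k\ge0$, $S_{k+1}$ has $k+1$ vertices $\{v\}\sqcup U\sqcup W$ with $|U|=\lfloor k/2\rfloor$, $|W|=\lceil k/2\rceil$; its edges are $(u,v)$ for all $u\in U$, $(v,w)$ for all $w\in W$, together with edges making the induced subdigraph on $U$ a copy of $S_{|U|}$ and the induced subdigraph on $W$ a copy of $S_{|W|}$ (no edges between $U$ and $W$). -}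

module Defs where

open import Data.Nat using (ℕ; zero; suc; _+_; _*_; _∸_; _^_; _≤_; _/_; _≡ᵇ_)
open import Data.Bool using (Bool; true; false; not; _∨_; _∧_; if_then_else_)
open import Data.Fin using (Fin; toℕ)
open import Data.List using (List; []; _∷_; [_]; map; concatMap; _++_; upTo; foldr; allFin)
open import Data.Bool.ListAction using (any; all)
open import Data.Vec using (Vec; lookup) renaming ([] to []ᵥ; _∷_ to _∷ᵥ_)
open import Data.Product using (_×_; _,_)
open import Relation.Binary.PropositionalEquality using (_≡_; _≢_)

record Digraph : Set where
  field
    v   : ℕ
    adj : Fin v → Fin v → Bool
open Digraph public

countB : {A : Set} → (A → Bool) → List A → ℕ
countB p = foldr (λ a r → if p a then suc r else r) 0

edgeCount : Digraph → ℕ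
edgeCount D = countB (λ xy → adj D (Data.Product.proj₁ xy) (Data.Product.proj₂ xy))
                     (concatMap (λ x → map (λ y → x , y) (allFin (v D))) (allFin (v D)))

IsTournament : (n : ℕ) → (Fin n → Fin n → Bool) → Set
IsTournament n T = (∀ i → T i i ≡ false) × (∀ i j → i ≢ j → T i j ≡ not (T j i))

allMaps : (m n : ℕ) → List (Vec (Fin n) m)
allMaps zero    n = [ []ᵥ ]
allMaps (suc m) n = concatMap (λ i → map (i ∷ᵥ_) (allMaps m n)) (allFin n)

isHom : (D : Digraph) {n : ℕ} → (Fin n → Fin n → Bool) → Vec (Fin n) (v D) → Bool
isHom D T φ = all (λ x → all (λ y → not (adj D x y) ∨ T (lookup φ x) (lookup φ y))
                              (allFin (v D))) (allFin (v D))

homCount : (D : Digraph) (n : ℕ) → (Fin n → Fin n → Bool) → ℕ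
homCount D n T = countB (isHom D T) (allMaps (v D) n)

-- D is tournament anti-Sidorenko: t_D(T) ≤ 2^{-e(D)} for every tournament T (with v(T) ≥ 1),
-- i.e. h_D(T) * 2^{e(D)} ≤ v(T)^{v(D)}.
AntiSidorenko : Digraph → Set
AntiSidorenko D = ∀ (n : ℕ) (T : Fin n → Fin n → Bool) → 1 ≤ n → IsTournament n T →
                  homCount D n T * 2 ^ edgeCount D ≤ n ^ v D

-- edge list (on labels ℕ) of the iterated balanced star S_j whose vertices are
-- labelled o, o+1, ..., o+j-1: centre o, U = next ⌊k/2⌋ labels, W = the remaining ⌈k/2⌉.
-- The first argument is fuel (≥ j suffices).
starEdges : (fuel j o : ℕ) → List (ℕ × ℕ)
starEdges zero     _       _ = []
starEdges (suc f)  zero    _ = []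
starEdges (suc f)  (suc k) o =
  map (λ i → (suc o + i , o)) (upTo a)
  ++ map (λ i → (o , suc o + a + i)) (upTo b)
  ++ starEdges f a (suc o)
  ++ starEdges f b (suc o + a)
  where
  a = k / 2
  b = k ∸ a

memPair : ℕ → ℕ → List (ℕ × ℕ) → Bool
memPair x y = any (λ p → (Data.Product.proj₁ p ≡ᵇ x) ∧ (Data.Product.proj₂ p ≡ᵇ y))

S : ℕ → Digraph
S j = record { v = j ; adj = λ x y → memPair (toℕ x) (toℕ y) (starEdges j j 0) }

-- Let h(j, Q) count the homomorphisms from S_j into the subtournament induced by a vertex set Q.
-- Sending the centre of S_{k+1} to c forces its in-subtree S_a into N⁻(c) ∩ Q and its out-subtree
-- S_b into N⁺(c) ∩ Q (a = ⌊k/2⌋, b = ⌈k/2⌉), so induction on j gives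
--   h(k+1, Q) 2^{e(S_{k+1})} ≤ Σ_{c ∈ Q} 2^{a+b} |N⁻(c) ∩ Q|^a |N⁺(c) ∩ Q|^b.
-- In a tournament |N⁻(c) ∩ Q| + |N⁺(c) ∩ Q| ≤ |Q|, so AM-GM bounds each term by |Q|^{2a} times a spare
-- factor: 1 when a = b, and 2|N⁺(c) ∩ Q| when b = a + 1, which sums over c to twice the number of
-- edges inside Q, i.e. at most |Q|². Hence h(j, Q) 2^{e(S_j)} ≤ |Q|^j; take Q = V(T).
module Submission where

open import Defs
open import Data.Bool using (Bool; true; false; T; _∧_; _∨_; if_then_else_)
open import Data.Bool.ListAction using (all; and)
open import Data.Bool.Properties using (T-∧; ∧-assoc)
open import Data.Bool.Solver using (module ∨-∧-Solver)
open import Data.Empty using (⊥-elim)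
open import Data.Fin using (Fin; toℕ; fromℕ<) renaming (zero to fzero; suc to fsuc)
open import Data.Fin.Properties using (toℕ-fromℕ<) renaming (_≟_ to _≟ᶠ_)
open import Data.List using (List; []; _∷_; map; concatMap; _++_; upTo; allFin; length)
open import Data.List.Properties
  using (map-++; map-∘; map-cong; map-cong-local; map-id; map-applyUpTo; map-upTo; map-tabulate;
         length-++; length-map; length-upTo; length-tabulate)
open import Data.List.Membership.Propositional using (_∈_)
open import Data.List.Membership.Propositional.Properties using (∈-allFin; ∈-upTo⁻)
open import Data.List.Relation.Unary.All as All using (All; []; _∷_)
open import Data.List.Relation.Unary.All.Properties using (all⁺; all⁻; ++⁺; map⁺)
open import Data.List.Relation.Unary.Any as Any using ()
open import Data.List.Relation.Unary.Any.Properties using (any⁺)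
open import Data.Nat using (ℕ; zero; suc; _+_; _*_; _∸_; _^_; _≤_; _<_; z≤n; s≤s; _/_; _%_; _≡ᵇ_)
open import Data.Nat.DivMod using (m≡m%n+[m/n]*n; m%n<n; m/n≤m)
open import Data.Nat.Properties
open import Data.Nat.Tactic.RingSolver using (solve-∀)
open import Data.Product using (_×_; _,_; proj₁; proj₂)
open import Data.Sum using (_⊎_; inj₁; inj₂; [_,_]′)
open import Data.Vec using (Vec; lookup; toList) renaming ([] to []ᵥ; _∷_ to _∷ᵥ_; _++_ to _++ᵥ_)
open import Data.Vec.Properties using (toList-++)
open import Function using (_∘_; Equivalence)
open import Relation.Binary.PropositionalEquality
open import Relation.Nullary using (yes; no)

private variable
  A B : Set

-- Finite sums and Boolean indicators

sumBy : (A → ℕ) → List A → ℕ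
sumBy f []       = 0
sumBy f (x ∷ xs) = f x + sumBy f xs

sumBy-++ : ∀ (f : A → ℕ) xs ys → sumBy f (xs ++ ys) ≡ sumBy f xs + sumBy f ys
sumBy-++ f []       ys = refl
sumBy-++ f (x ∷ xs) ys = trans (cong (f x +_) (sumBy-++ f xs ys)) (sym (+-assoc (f x) _ _))

sumBy-cong : ∀ {f g : A → ℕ} xs → (∀ x → f x ≡ g x) → sumBy f xs ≡ sumBy g xs
sumBy-cong []       f≗g = refl
sumBy-cong (x ∷ xs) f≗g = cong₂ _+_ (f≗g x) (sumBy-cong xs f≗g)

sumBy-mono : ∀ {f g : A → ℕ} xs → (∀ x → f x ≤ g x) → sumBy f xs ≤ sumBy g xs
sumBy-mono []       f≤g = z≤n
sumBy-mono (x ∷ xs) f≤g = +-mono-≤ (f≤g x) (sumBy-mono xs f≤g)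

sumBy-0 : ∀ (xs : List A) → sumBy (λ _ → 0) xs ≡ 0
sumBy-0 []       = refl
sumBy-0 (x ∷ xs) = sumBy-0 xs

sumBy-1 : ∀ (xs : List A) → sumBy (λ _ → 1) xs ≡ length xs
sumBy-1 []       = refl
sumBy-1 (x ∷ xs) = cong suc (sumBy-1 xs)

sumBy-+ : ∀ (f g : A → ℕ) xs → sumBy (λ x → f x + g x) xs ≡ sumBy f xs + sumBy g xs
sumBy-+ f g []       = refl
sumBy-+ f g (x ∷ xs) = trans (cong (f x + g x +_) (sumBy-+ f g xs)) (+-+-comm (f x) (g x) _ _)
  where
  +-+-comm : ∀ a b c d → a + b + (c + d) ≡ a + c + (b + d)
  +-+-comm = solve-∀

sumBy-*ˡ : ∀ c (f : A → ℕ) xs → sumBy (λ x → c * f x) xs ≡ c * sumBy f xs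
sumBy-*ˡ c f []       = sym (*-zeroʳ c)
sumBy-*ˡ c f (x ∷ xs) = trans (cong (c * f x +_) (sumBy-*ˡ c f xs)) (sym (*-distribˡ-+ c (f x) _))

sumBy-*ʳ : ∀ c (f : A → ℕ) xs → sumBy (λ x → f x * c) xs ≡ sumBy f xs * c
sumBy-*ʳ c f xs = trans (sumBy-cong xs (λ x → *-comm (f x) c)) (trans (sumBy-*ˡ c f xs) (*-comm c _))

sumBy-*-sumBy : ∀ (f : A → ℕ) (g : B → ℕ) xs ys →
                sumBy (λ x → sumBy (λ y → f x * g y) ys) xs ≡ sumBy f xs * sumBy g ys
sumBy-*-sumBy f g xs ys = trans (sumBy-cong xs (λ x → sumBy-*ˡ (f x) g ys)) (sumBy-*ʳ _ f xs)

sumBy-comm : ∀ (F : A → B → ℕ) xs ys →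
             sumBy (λ x → sumBy (F x) ys) xs ≡ sumBy (λ y → sumBy (λ x → F x y) xs) ys
sumBy-comm F []       ys = sym (sumBy-0 ys)
sumBy-comm F (x ∷ xs) ys = trans (cong (sumBy (F x) ys +_) (sumBy-comm F xs ys))
                                 (sym (sumBy-+ (F x) (λ y → sumBy (λ x → F x y) xs) ys))

sumBy-map : ∀ (f : B → ℕ) (g : A → B) xs → sumBy f (map g xs) ≡ sumBy (f ∘ g) xs
sumBy-map f g []       = refl
sumBy-map f g (x ∷ xs) = cong (f (g x) +_) (sumBy-map f g xs)

sumBy-concatMap : ∀ (f : B → ℕ) (g : A → List B) xs →
                  sumBy f (concatMap g xs) ≡ sumBy (λ x → sumBy f (g x)) xs
sumBy-concatMap f g []       = refl
sumBy-concatMap f g (x ∷ xs) =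
  trans (sumBy-++ f (g x) (concatMap g xs)) (cong (sumBy f (g x) +_) (sumBy-concatMap f g xs))

sumBy-allFin-suc : ∀ {j} (f : Fin (suc j) → ℕ) → sumBy f (allFin (suc j)) ≡ f fzero + sumBy (f ∘ fsuc) (allFin j)
sumBy-allFin-suc {j} f =
  cong (f fzero +_) (trans (cong (sumBy f) (sym (map-tabulate (λ x → x) fsuc))) (sumBy-map f fsuc (allFin j)))

𝟙 : Bool → ℕ
𝟙 b = if b then 1 else 0

𝟙-∧ : ∀ x y → 𝟙 (x ∧ y) ≡ 𝟙 x * 𝟙 y
𝟙-∧ true  y = sym (+-identityʳ (𝟙 y))
𝟙-∧ false y = refl

𝟙-∨ : ∀ x y → 𝟙 (x ∨ y) ≤ 𝟙 x + 𝟙 y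
𝟙-∨ true  y = s≤s z≤n
𝟙-∨ false y = ≤-refl

𝟙-mono : ∀ {x y} → (T x → T y) → 𝟙 x ≤ 𝟙 y
𝟙-mono {false}         x⇒y = z≤n
𝟙-mono {true}  {true}  x⇒y = ≤-refl
𝟙-mono {true}  {false} x⇒y = ⊥-elim (x⇒y _)

countB≡sumBy-𝟙 : ∀ (p : A → Bool) xs → countB p xs ≡ sumBy (𝟙 ∘ p) xs
countB≡sumBy-𝟙 p []       = refl
countB≡sumBy-𝟙 p (x ∷ xs) with p x
... | true  = cong suc (countB≡sumBy-𝟙 p xs)
... | false = countB≡sumBy-𝟙 p xs

all-++ : ∀ (p : A → Bool) xs ys → all p (xs ++ ys) ≡ all p xs ∧ all p ys
all-++ p []       ys = refl
all-++ p (x ∷ xs) ys = trans (cong (p x ∧_) (all-++ p xs ys)) (sym (∧-assoc (p x) _ _))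


all-map : ∀ (p : B → Bool) (f : A → B) xs → all p (map f xs) ≡ all (p ∘ f) xs
all-map p f xs = cong and (sym (map-∘ xs))

all-cong : ∀ {p q : A → Bool} xs → (∀ x → p x ≡ q x) → all p xs ≡ all q xs
all-cong xs p≗q = cong and (map-cong p≗q xs)

all-cong-local : ∀ {p q : A → Bool} {xs} → All (λ x → p x ≡ q x) xs → all p xs ≡ all q xs
all-cong-local p≗q = cong and (map-cong-local p≗q)

all-∧ : ∀ (p q : A → Bool) xs → all p xs ∧ all q xs ≡ all (λ x → p x ∧ q x) xs
all-∧ p q []       = refl
all-∧ p q (x ∷ xs) = trans (interchange (p x) (all p xs) (q x) (all q xs)) (cong ((p x ∧ q x) ∧_) (all-∧ p q xs))
  where
  open ∨-∧-Solver
  interchange : ∀ a b c d → (a ∧ b) ∧ (c ∧ d) ≡ (a ∧ c) ∧ (b ∧ d)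
  interchange = solve 4 (λ a b c d → (a :* b) :* (c :* d) := (a :* c) :* (b :* d)) refl

sumBy-allMaps-suc : ∀ m n (F : Vec (Fin n) (suc m) → ℕ) →
  sumBy F (allMaps (suc m) n) ≡ sumBy (λ c → sumBy (λ r → F (c ∷ᵥ r)) (allMaps m n)) (allFin n)
sumBy-allMaps-suc m n F = trans (sumBy-concatMap F _ (allFin n))
  (sumBy-cong (allFin n) (λ c → sumBy-map F (c ∷ᵥ_) (allMaps m n)))

sumBy-allMaps-++ : ∀ a b n (F : Vec (Fin n) (a + b) → ℕ) →
  sumBy F (allMaps (a + b) n) ≡ sumBy (λ u → sumBy (λ w → F (u ++ᵥ w)) (allMaps b n)) (allMaps a n)
sumBy-allMaps-++ zero    b n F = sym (+-identityʳ _)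
sumBy-allMaps-++ (suc a) b n F =
  trans (sumBy-allMaps-suc (a + b) n F)
  (trans (sumBy-cong (allFin n) (λ c → sumBy-allMaps-++ a b n (λ r → F (c ∷ᵥ r))))
         (sym (sumBy-allMaps-suc a n _)))

half-split : ∀ k → k / 2 + (k ∸ k / 2) ≡ k
half-split k = m+[n∸m]≡n (m/n≤m k 2)

half-split-cases : ∀ k → k ∸ k / 2 ≡ k / 2 ⊎ k ∸ k / 2 ≡ suc (k / 2)
half-split-cases k = cases (k % 2) (k / 2) (m≡m%n+[m/n]*n k 2) (m%n<n k 2)
  where
  double : ∀ h → h * 2 ≡ h + h
  double = solve-∀
  cases : ∀ r h → k ≡ r + h * 2 → r < 2 → k ∸ h ≡ h ⊎ k ∸ h ≡ suc h
  cases zero          h refl _ = inj₁ (trans (cong (_∸ h) (double h)) (m+n∸n≡m h h))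
  cases (suc zero)    h refl _ = inj₂ (trans (cong (λ m → suc m ∸ h) (double h)) (m+n∸n≡m (suc h) h))
  cases (suc (suc r)) h _ (s≤s (s≤s ()))

^-distribʳ-* : ∀ x y a → (x * y) ^ a ≡ x ^ a * y ^ a
^-distribʳ-* x y zero    = refl
^-distribʳ-* x y (suc a) = trans (cong (x * y *_) (^-distribʳ-* x y a)) (*-*-comm x y _ _)
  where
  *-*-comm : ∀ x y p q → x * y * (p * q) ≡ x * p * (y * q)
  *-*-comm = solve-∀

4xy≤[x+y]² : ∀ x y → 4 * (x * y) ≤ (x + y) * (x + y)
4xy≤[x+y]² x y = [ ordered , swapped ]′ (≤-total x y)
  where
  ordered : ∀ {x y} → x ≤ y → 4 * (x * y) ≤ (x + y) * (x + y)
  ordered {x} x≤y with d , refl ← m≤n⇒∃[o]m+o≡n x≤y =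
    subst (4 * (x * (x + d)) ≤_) (square-expansion x d) (m≤m+n _ (d * d))
    where
    square-expansion : ∀ x d → 4 * (x * (x + d)) + d * d ≡ (x + (x + d)) * (x + (x + d))
    square-expansion = solve-∀
  swapped : y ≤ x → 4 * (x * y) ≤ (x + y) * (x + y)
  swapped y≤x = subst₂ _≤_ (cong (4 *_) (*-comm y x)) (cong (λ s → s * s) (+-comm y x)) (ordered y≤x)

am-gm-power : ∀ x y m a → x + y ≤ m → 2 ^ (a + a) * (x ^ a * y ^ a) ≤ m ^ (a + a)
am-gm-power x y m a x+y≤m = begin
    2 ^ (a + a) * (x ^ a * y ^ a)
  ≡⟨ cong₂ _*_ (trans (^-distribˡ-+-* 2 a a) (sym (^-distribʳ-* 2 2 a))) (sym (^-distribʳ-* x y a)) ⟩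
    4 ^ a * (x * y) ^ a
  ≡⟨ ^-distribʳ-* 4 (x * y) a ⟨
    (4 * (x * y)) ^ a
  ≤⟨ ^-monoˡ-≤ a (≤-trans (4xy≤[x+y]² x y) (*-mono-≤ x+y≤m x+y≤m)) ⟩
    (m * m) ^ a
  ≡⟨ trans (^-distribʳ-* m m a) (sym (^-distribˡ-+-* m a a)) ⟩
    m ^ (a + a) ∎
  where open ≤-Reasoning

-- Edge lists of iterated balanced stars

shiftBy : ℕ → ℕ × ℕ → ℕ × ℕ
shiftBy o e = o + proj₁ e , o + proj₂ e

-- starEdges (suc f) (suc k) 0 unfolds to glueEdges f (k / 2) (k ∸ k / 2).
glueEdges : (f a b : ℕ) → List (ℕ × ℕ)
glueEdges f a b = map (λ i → suc i , 0) (upTo a) ++ map (λ i → 0 , suc a + i) (upTo b)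
                  ++ starEdges f a 1 ++ starEdges f b (suc a)

starEdges-suc : ∀ f j o → starEdges f j (suc o) ≡ map (shiftBy 1) (starEdges f j o)
starEdges-suc zero    j       o = refl
starEdges-suc (suc f) zero    o = refl
starEdges-suc (suc f) (suc k) o = begin
    map (shiftBy 1 ∘ ul) (upTo a) ++ map (shiftBy 1 ∘ wl) (upTo b)
      ++ starEdges f a (suc (suc o)) ++ starEdges f b (suc (suc o + a))
  ≡⟨ cong₂ _++_ (map-∘ (upTo a)) (cong₂ _++_ (map-∘ (upTo b))
       (cong₂ _++_ (starEdges-suc f a (suc o)) (starEdges-suc f b (suc o + a)))) ⟩
    map (shiftBy 1) (map ul (upTo a)) ++ map (shiftBy 1) (map wl (upTo b))
      ++ map (shiftBy 1) (starEdges f a (suc o)) ++ map (shiftBy 1) (starEdges f b (suc o + a))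
  ≡⟨ map-++₄ (shiftBy 1) (map ul (upTo a)) (map wl (upTo b)) (starEdges f a (suc o)) _ ⟨
    map (shiftBy 1) (starEdges (suc f) (suc k) o) ∎
  where
  open ≡-Reasoning
  a = k / 2
  b = k ∸ a
  ul wl : ℕ → ℕ × ℕ
  ul i = suc o + i , o
  wl i = o , suc o + a + i
  map-++₄ : ∀ (g : A → B) xs ys zs ws → map g (xs ++ ys ++ zs ++ ws) ≡ map g xs ++ map g ys ++ map g zs ++ map g ws
  map-++₄ g xs ys zs ws =
    trans (map-++ g xs _) (cong (map g xs ++_) (trans (map-++ g ys _) (cong (map g ys ++_) (map-++ g zs ws))))

starEdges-shift : ∀ f j o → starEdges f j o ≡ map (shiftBy o) (starEdges f j 0)
starEdges-shift f j zero    = sym (map-id _)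
starEdges-shift f j (suc o) =
  trans (starEdges-suc f j o) (trans (cong (map (shiftBy 1)) (starEdges-shift f j o)) (sym (map-∘ _)))

length-glueEdges : ∀ f a b →
  length (glueEdges f a b) ≡ a + (b + (length (starEdges f a 0) + length (starEdges f b 0)))
length-glueEdges f a b =
  trans (length-++ (map _ (upTo a)))
  (cong₂ _+_ (trans (length-map _ (upTo a)) (length-upTo a))
  (trans (length-++ (map _ (upTo b)))
  (cong₂ _+_ (trans (length-map _ (upTo b)) (length-upTo b))
  (trans (length-++ (starEdges f a 1))
  (cong₂ _+_ (shifted-length a 1) (shifted-length b (suc a)))))))
  where
  shifted-length : ∀ j o → length (starEdges f j o) ≡ length (starEdges f j 0)
  shifted-length j o = trans (cong length (starEdges-shift f j o)) (length-map _ (starEdges f j 0))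

Bounded : ℕ → ℕ × ℕ → Set
Bounded j e = proj₁ e < j × proj₂ e < j

bounded-shift : ∀ {j m} o E → o + j ≤ m → All (Bounded j) E → All (Bounded m) (map (shiftBy o) E)
bounded-shift o E o+j≤m bE =
  map⁺ (All.map (λ (x<j , y<j) → ≤-trans (+-monoʳ-< o x<j) o+j≤m , ≤-trans (+-monoʳ-< o y<j) o+j≤m) bE)

starEdges-bounded : ∀ f j → All (Bounded j) (starEdges f j 0)
starEdges-bounded zero    j       = []
starEdges-bounded (suc f) zero    = []
starEdges-bounded (suc f) (suc k) =
  ++⁺ (map⁺ {xs = upTo a} (All.tabulate (λ i∈ → s≤s (≤-trans (∈-upTo⁻ i∈) a≤k) , s≤s z≤n)))
  (++⁺ (map⁺ {xs = upTo b} (All.tabulate (λ i∈ →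
         s≤s z≤n , s≤s (subst (a + _ <_) (half-split k) (+-monoʳ-< a (∈-upTo⁻ i∈))))))
  (++⁺ (subst (All _) (sym (starEdges-shift f a 1)) (bounded-shift 1 _ (s≤s a≤k) (starEdges-bounded f a)))
       (subst (All _) (sym (starEdges-shift f b (suc a)))
              (bounded-shift (suc a) _ (≤-reflexive (cong suc (half-split k))) (starEdges-bounded f b)))))
  where
  a = k / 2
  b = k ∸ a
  a≤k : a ≤ k
  a≤k = m/n≤m k 2

-- Counting homomorphisms of stars into a tournament

module _ {n : ℕ} (default : Fin n) where

  valueAt : ∀ {m} → Vec (Fin n) m → ℕ → Fin n
  valueAt []ᵥ       _       = default
  valueAt (x ∷ᵥ xs) zero    = x
  valueAt (x ∷ᵥ xs) (suc i) = valueAt xs i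

  valueAt-lookup : ∀ {m} (xs : Vec (Fin n) m) i → valueAt xs (toℕ i) ≡ lookup xs i
  valueAt-lookup (x ∷ᵥ xs) fzero    = refl
  valueAt-lookup (x ∷ᵥ xs) (fsuc i) = valueAt-lookup xs i

  valueAt-++ˡ : ∀ {a b} (u : Vec (Fin n) a) (w : Vec (Fin n) b) {i} → i < a → valueAt (u ++ᵥ w) i ≡ valueAt u i
  valueAt-++ˡ (x ∷ᵥ u) w {zero}  _         = refl
  valueAt-++ˡ (x ∷ᵥ u) w {suc i} (s≤s i<a) = valueAt-++ˡ u w i<a

  valueAt-++ʳ : ∀ {a b} (u : Vec (Fin n) a) (w : Vec (Fin n) b) i → valueAt (u ++ᵥ w) (a + i) ≡ valueAt w i
  valueAt-++ʳ []ᵥ       w i = refl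
  valueAt-++ʳ (x ∷ᵥ u) w i = valueAt-++ʳ u w i

  map-valueAt-upTo : ∀ {a} (u : Vec (Fin n) a) → map (valueAt u) (upTo a) ≡ toList u
  map-valueAt-upTo []ᵥ               = refl
  map-valueAt-upTo {suc a} (x ∷ᵥ u) =
    cong (x ∷_) (trans (map-applyUpTo suc (valueAt (x ∷ᵥ u)) a)
                (trans (sym (map-upTo (valueAt u) a)) (map-valueAt-upTo u)))

  map-valueAt-++-upTo : ∀ {a b} (u : Vec (Fin n) a) (w : Vec (Fin n) b) → map (valueAt (u ++ᵥ w)) (upTo a) ≡ toList u
  map-valueAt-++-upTo u w =
    trans (map-cong-local (All.tabulate (λ i∈ → valueAt-++ˡ u w (∈-upTo⁻ i∈)))) (map-valueAt-upTo u)

∣_∣ : ∀ {n} → (Fin n → Bool) → ℕ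
∣ Q ∣ = sumBy (𝟙 ∘ Q) (allFin _)

module _ {n : ℕ} (Tr : Fin n → Fin n → Bool) where

  Respects : (ℕ → Fin n) → List (ℕ × ℕ) → Bool
  Respects g = all (λ e → Tr (g (proj₁ e)) (g (proj₂ e)))

  respects-shift : ∀ o g E → Respects g (map (shiftBy o) E) ≡ Respects (λ i → g (o + i)) E
  respects-shift o g E = all-map _ (shiftBy o) E

  respects-cong : ∀ {g g'} E → (∀ i → g i ≡ g' i) → Respects g E ≡ Respects g' E
  respects-cong E g≗g' = all-cong E (λ e → cong₂ Tr (g≗g' (proj₁ e)) (g≗g' (proj₂ e)))

  respects-local : ∀ {j g g'} {E} → All (Bounded j) E → (∀ {i} → i < j → g i ≡ g' i) →
                   Respects g E ≡ Respects g' E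
  respects-local bE g≗g' = all-cong-local (All.map (λ (x<j , y<j) → cong₂ Tr (g≗g' x<j) (g≗g' y<j)) bE)

  inNbhd outNbhd : (Fin n → Bool) → Fin n → Fin n → Bool
  inNbhd  Q c y = Q y ∧ Tr y c
  outNbhd Q c y = Q y ∧ Tr c y

  d⁻ d⁺ : (Fin n → Bool) → Fin n → ℕ
  d⁻ Q c = ∣ inNbhd Q c ∣
  d⁺ Q c = ∣ outNbhd Q c ∣

  outdegree-sum≡indegree-sum : ∀ Q →
    sumBy (λ c → 𝟙 (Q c) * d⁺ Q c) (allFin n) ≡ sumBy (λ c → 𝟙 (Q c) * d⁻ Q c) (allFin n)
  outdegree-sum≡indegree-sum Q = begin
      sumBy (λ c → 𝟙 (Q c) * d⁺ Q c) (allFin n)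
    ≡⟨ sumBy-cong (allFin n) (λ c → sumBy-*ˡ (𝟙 (Q c)) _ (allFin n)) ⟨
      sumBy (λ c → sumBy (λ y → 𝟙 (Q c) * 𝟙 (Q y ∧ Tr c y)) (allFin n)) (allFin n)
    ≡⟨ sumBy-cong (allFin n) (λ c → sumBy-cong (allFin n) (λ y → 𝟙-swap (Q c) (Q y) (Tr c y))) ⟩
      sumBy (λ c → sumBy (λ y → 𝟙 (Q y) * 𝟙 (Q c ∧ Tr c y)) (allFin n)) (allFin n)
    ≡⟨ sumBy-comm (λ c y → 𝟙 (Q y) * 𝟙 (Q c ∧ Tr c y)) (allFin n) (allFin n) ⟩
      sumBy (λ y → sumBy (λ c → 𝟙 (Q y) * 𝟙 (Q c ∧ Tr c y)) (allFin n)) (allFin n)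
    ≡⟨ sumBy-cong (allFin n) (λ y → sumBy-*ˡ (𝟙 (Q y)) _ (allFin n)) ⟩
      sumBy (λ y → 𝟙 (Q y) * d⁻ Q y) (allFin n) ∎
    where
    open ≡-Reasoning
    𝟙-swap : ∀ q q' t → 𝟙 q * 𝟙 (q' ∧ t) ≡ 𝟙 q' * 𝟙 (q ∧ t)
    𝟙-swap q q' t = trans (cong (𝟙 q *_) (𝟙-∧ q' t))
      (trans (sym (*-assoc (𝟙 q) _ _)) (trans (cong (_* 𝟙 t) (*-comm (𝟙 q) (𝟙 q')))
      (trans (*-assoc (𝟙 q') _ _) (cong (𝟙 q' *_) (sym (𝟙-∧ q t))))))

  module _ (tournament : IsTournament n Tr) where

    d⁻+d⁺≤∣Q∣ : ∀ Q c → d⁻ Q c + d⁺ Q c ≤ ∣ Q ∣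
    d⁻+d⁺≤∣Q∣ Q c =
      ≤-trans (≤-reflexive (sym (sumBy-+ _ _ (allFin n)))) (sumBy-mono (allFin n) at-most-one-direction)
      where
      at-most-one-direction : ∀ y → 𝟙 (Q y ∧ Tr y c) + 𝟙 (Q y ∧ Tr c y) ≤ 𝟙 (Q y)
      at-most-one-direction y with Q y | y ≟ᶠ c
      ... | false | _        = z≤n
      ... | true  | yes refl rewrite proj₁ tournament y = z≤n
      ... | true  | no y≢c   rewrite proj₂ tournament y c y≢c with Tr c y
      ...   | true  = ≤-refl
      ...   | false = ≤-refl

    2*outdegree-sum≤∣Q∣² : ∀ Q → 2 * sumBy (λ c → 𝟙 (Q c) * d⁺ Q c) (allFin n) ≤ ∣ Q ∣ * ∣ Q ∣
    2*outdegree-sum≤∣Q∣² Q = begin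
        2 * out
      ≡⟨ cong (out +_) (trans (+-identityʳ out) (outdegree-sum≡indegree-sum Q)) ⟩
        out + sumBy (λ c → 𝟙 (Q c) * d⁻ Q c) (allFin n)
      ≡⟨ sumBy-+ _ _ (allFin n) ⟨
        sumBy (λ c → 𝟙 (Q c) * d⁺ Q c + 𝟙 (Q c) * d⁻ Q c) (allFin n)
      ≤⟨ sumBy-mono (allFin n) (λ c → ≤-trans (≤-reflexive (sym (*-distribˡ-+ (𝟙 (Q c)) _ _)))
           (*-monoʳ-≤ (𝟙 (Q c)) (subst (_≤ ∣ Q ∣) (+-comm (d⁻ Q c) _) (d⁻+d⁺≤∣Q∣ Q c)))) ⟩
        sumBy (λ c → 𝟙 (Q c) * ∣ Q ∣) (allFin n)
      ≡⟨ sumBy-*ʳ ∣ Q ∣ _ (allFin n) ⟩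
        ∣ Q ∣ * ∣ Q ∣ ∎
      where
      open ≤-Reasoning
      out = sumBy (λ c → 𝟙 (Q c) * d⁺ Q c) (allFin n)

    degree-product-sum-bound : ∀ Q a b → b ≡ a ⊎ b ≡ suc a →
      sumBy (λ c → 𝟙 (Q c) * (2 ^ (a + b) * (d⁻ Q c ^ a * d⁺ Q c ^ b))) (allFin n) ≤ ∣ Q ∣ ^ suc (a + b)
    degree-product-sum-bound Q a .a (inj₁ refl) = begin
        sumBy (λ c → 𝟙 (Q c) * (2 ^ (a + a) * (d⁻ Q c ^ a * d⁺ Q c ^ a))) (allFin n)
      ≤⟨ sumBy-mono (allFin n) (λ c → *-monoʳ-≤ (𝟙 (Q c)) (am-gm-power _ _ _ a (d⁻+d⁺≤∣Q∣ Q c))) ⟩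
        sumBy (λ c → 𝟙 (Q c) * ∣ Q ∣ ^ (a + a)) (allFin n)
      ≡⟨ sumBy-*ʳ _ _ (allFin n) ⟩
        ∣ Q ∣ * ∣ Q ∣ ^ (a + a) ∎
      where open ≤-Reasoning
    degree-product-sum-bound Q a .(suc a) (inj₂ refl) = begin
        sumBy (λ c → 𝟙 (Q c) * (2 ^ (a + suc a) * (d⁻ Q c ^ a * d⁺ Q c ^ suc a))) (allFin n)
      ≡⟨ sumBy-cong (allFin n) (λ c →
           trans (cong (λ m → 𝟙 (Q c) * (2 ^ m * (d⁻ Q c ^ a * d⁺ Q c ^ suc a))) (+-suc a a))
           (peel-off (𝟙 (Q c)) (2 ^ (a + a)) (d⁻ Q c ^ a) (d⁺ Q c ^ a) (d⁺ Q c))) ⟩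
        sumBy (λ c → 2 ^ (a + a) * (d⁻ Q c ^ a * d⁺ Q c ^ a) * (2 * (𝟙 (Q c) * d⁺ Q c))) (allFin n)
      ≤⟨ sumBy-mono (allFin n) (λ c → *-monoˡ-≤ _ (am-gm-power _ _ _ a (d⁻+d⁺≤∣Q∣ Q c))) ⟩
        sumBy (λ c → ∣ Q ∣ ^ (a + a) * (2 * (𝟙 (Q c) * d⁺ Q c))) (allFin n)
      ≡⟨ trans (sumBy-*ˡ (∣ Q ∣ ^ (a + a)) _ (allFin n)) (cong (∣ Q ∣ ^ (a + a) *_) (sumBy-*ˡ 2 _ (allFin n))) ⟩
        ∣ Q ∣ ^ (a + a) * (2 * sumBy (λ c → 𝟙 (Q c) * d⁺ Q c) (allFin n))
      ≤⟨ *-monoʳ-≤ (∣ Q ∣ ^ (a + a)) (2*outdegree-sum≤∣Q∣² Q) ⟩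
        ∣ Q ∣ ^ (a + a) * (∣ Q ∣ * ∣ Q ∣)
      ≡⟨ trans (*-comm (∣ Q ∣ ^ (a + a)) _)
               (trans (*-assoc ∣ Q ∣ ∣ Q ∣ _) (cong (λ m → ∣ Q ∣ ^ suc m) (sym (+-suc a a)))) ⟩
        ∣ Q ∣ ^ suc (a + suc a) ∎
      where
      open ≤-Reasoning
      peel-off : ∀ q t x y z → q * (2 * t * (x * (z * y))) ≡ t * (x * y) * (2 * (q * z))
      peel-off = solve-∀

  module _ (default : Fin n) where

    respects-glueEdges : ∀ f {a b} c (u : Vec (Fin n) a) (w : Vec (Fin n) b) →
      Respects (valueAt default (c ∷ᵥ u ++ᵥ w)) (glueEdges f a b)
        ≡ all (λ y → Tr y c) (toList u) ∧ all (Tr c) (toList w)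
          ∧ Respects (valueAt default u) (starEdges f a 0) ∧ Respects (valueAt default w) (starEdges f b 0)
    respects-glueEdges f {a} {b} c u w =
      trans (all-++ _ (map _ (upTo a)) _) (cong₂ _∧_ in-edges
      (trans (all-++ _ (map _ (upTo b)) _) (cong₂ _∧_ out-edges
      (trans (all-++ _ (starEdges f a 1) _) (cong₂ _∧_ lower-star upper-star)))))
      where
      g = valueAt default (c ∷ᵥ u ++ᵥ w)
      in-edges : Respects g (map (λ i → suc i , 0) (upTo a)) ≡ all (λ y → Tr y c) (toList u)
      in-edges = trans (all-map _ _ (upTo a)) (trans (sym (all-map (λ y → Tr y c) _ (upTo a)))
                   (cong (all _) (map-valueAt-++-upTo default u w)))
      out-edges : Respects g (map (λ i → 0 , suc a + i) (upTo b)) ≡ all (Tr c) (toList w)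
      out-edges = trans (all-map _ _ (upTo b))
                  (trans (all-cong (upTo b) (λ i → cong (Tr c) (valueAt-++ʳ default u w i)))
                  (trans (sym (all-map (Tr c) _ (upTo b))) (cong (all _) (map-valueAt-upTo default w))))
      lower-star : Respects g (starEdges f a 1) ≡ Respects (valueAt default u) (starEdges f a 0)
      lower-star = trans (cong (Respects g) (starEdges-shift f a 1))
                   (trans (respects-shift 1 g (starEdges f a 0))
                   (respects-local (starEdges-bounded f a) (valueAt-++ˡ default u w)))
      upper-star : Respects g (starEdges f b (suc a)) ≡ Respects (valueAt default w) (starEdges f b 0)
      upper-star = trans (cong (Respects g) (starEdges-shift f b (suc a)))
                   (trans (respects-shift (suc a) g (starEdges f b 0))
                   (respects-cong (starEdges f b 0) (valueAt-++ʳ default u w)))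

    isStarHom : (f j : ℕ) → (Fin n → Bool) → Vec (Fin n) j → Bool
    isStarHom f j Q ψ = all Q (toList ψ) ∧ Respects (valueAt default ψ) (starEdges f j 0)

    starHomCount : (f j : ℕ) → (Fin n → Bool) → ℕ
    starHomCount f j Q = sumBy (𝟙 ∘ isStarHom f j Q) (allMaps j n)

    isStarHom-glue : ∀ f {a b} Q c (u : Vec (Fin n) a) (w : Vec (Fin n) b) →
      all Q (toList (c ∷ᵥ u ++ᵥ w)) ∧ Respects (valueAt default (c ∷ᵥ u ++ᵥ w)) (glueEdges f a b)
        ≡ Q c ∧ (isStarHom f a (inNbhd Q c) u ∧ isStarHom f b (outNbhd Q c) w)
    isStarHom-glue f {a} {b} Q c u w = begin
        (Q c ∧ all Q (toList (u ++ᵥ w))) ∧ Respects (valueAt default (c ∷ᵥ u ++ᵥ w)) (glueEdges f a b)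
      ≡⟨ cong₂ (λ x y → (Q c ∧ x) ∧ y)
               (trans (cong (all Q) (toList-++ u w)) (all-++ Q (toList u) (toList w)))
               (respects-glueEdges f {a} {b} c u w) ⟩
        (Q c ∧ qu ∧ qw) ∧ (eu ∧ ew ∧ su ∧ sw)
      ≡⟨ regroup (Q c) qu qw eu ew su sw ⟩
        Q c ∧ ((qu ∧ eu) ∧ su) ∧ ((qw ∧ ew) ∧ sw)
      ≡⟨ cong₂ (λ x y → Q c ∧ (x ∧ su) ∧ (y ∧ sw)) (all-∧ Q _ (toList u)) (all-∧ Q _ (toList w)) ⟩
        Q c ∧ ((all (inNbhd Q c) (toList u) ∧ su) ∧ (all (outNbhd Q c) (toList w) ∧ sw)) ∎
      where
      open ≡-Reasoning
      open ∨-∧-Solver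
      qu = all Q (toList u)
      qw = all Q (toList w)
      eu = all (λ y → Tr y c) (toList u)
      ew = all (Tr c) (toList w)
      su = Respects (valueAt default u) (starEdges f a 0)
      sw = Respects (valueAt default w) (starEdges f b 0)
      regroup : ∀ x p q r s t v → (x ∧ p ∧ q) ∧ (r ∧ s ∧ t ∧ v) ≡ x ∧ ((p ∧ r) ∧ t) ∧ ((q ∧ s) ∧ v)
      regroup = solve 7 (λ x p q r s t v →
        (x :* (p :* q)) :* (r :* (s :* (t :* v))) := x :* (((p :* r) :* t) :* ((q :* s) :* v))) refl

    starHomCount-glue : ∀ f {k} a b → a + b ≡ k → ∀ Q c →
      sumBy (λ r → 𝟙 (all Q (toList (c ∷ᵥ r)) ∧ Respects (valueAt default (c ∷ᵥ r)) (glueEdges f a b))) (allMaps k n)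
        ≡ 𝟙 (Q c) * (starHomCount f a (inNbhd Q c) * starHomCount f b (outNbhd Q c))
    starHomCount-glue f a b refl Q c =
      trans (sumBy-allMaps-++ a b n _)
      (trans (sumBy-cong (allMaps a n) (λ u → trans (sumBy-cong (allMaps b n) (λ w → factor u w))
                                                    (sumBy-*ˡ (𝟙 (Q c)) _ (allMaps b n))))
      (trans (sumBy-*ˡ (𝟙 (Q c)) _ (allMaps a n))
             (cong (𝟙 (Q c) *_) (sumBy-*-sumBy _ _ (allMaps a n) (allMaps b n)))))
      where
      factor : ∀ u w → 𝟙 (all Q (toList (c ∷ᵥ u ++ᵥ w)) ∧ Respects (valueAt default (c ∷ᵥ u ++ᵥ w)) (glueEdges f a b))
                       ≡ 𝟙 (Q c) * (𝟙 (isStarHom f a (inNbhd Q c) u) * 𝟙 (isStarHom f b (outNbhd Q c) w))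
      factor u w = trans (cong 𝟙 (isStarHom-glue f Q c u w))
                   (trans (𝟙-∧ (Q c) _) (cong (𝟙 (Q c) *_) (𝟙-∧ (isStarHom f a (inNbhd Q c) u) _)))

    starHomCount-suc : ∀ f k Q → starHomCount (suc f) (suc k) Q
      ≡ sumBy (λ c → 𝟙 (Q c) * (starHomCount f (k / 2) (inNbhd Q c) * starHomCount f (k ∸ k / 2) (outNbhd Q c))) (allFin n)
    starHomCount-suc f k Q = trans (sumBy-allMaps-suc k n _)
      (sumBy-cong (allFin n) (starHomCount-glue f (k / 2) (k ∸ k / 2) (half-split k) Q))

    starHomCount-bound : IsTournament n Tr → ∀ f j → j ≤ f → ∀ Q →
                         starHomCount f j Q * 2 ^ length (starEdges f j 0) ≤ ∣ Q ∣ ^ j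
    starHomCount-bound tournament zero    zero    _         Q = ≤-refl
    starHomCount-bound tournament (suc f) zero    _         Q = ≤-refl
    starHomCount-bound tournament (suc f) (suc k) (s≤s k≤f) Q = begin
        starHomCount (suc f) (suc k) Q * 2 ^ length (glueEdges f a b)
      ≡⟨ cong₂ _*_ (starHomCount-suc f k Q) (cong (2 ^_) (length-glueEdges f a b)) ⟩
        sumBy (λ c → 𝟙 (Q c) * (lower c * upper c)) (allFin n) * 2 ^ (a + (b + (la + lb)))
      ≡⟨ sumBy-*ʳ _ _ (allFin n) ⟨
        sumBy (λ c → 𝟙 (Q c) * (lower c * upper c) * 2 ^ (a + (b + (la + lb)))) (allFin n)
      ≡⟨ sumBy-cong (allFin n) (λ c → trans (cong (𝟙 (Q c) * (lower c * upper c) *_) split-power)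
                                             (regroup (𝟙 (Q c)) (lower c) (upper c) (2 ^ (a + b)) (2 ^ la) (2 ^ lb))) ⟩
        sumBy (λ c → 𝟙 (Q c) * (2 ^ (a + b) * ((lower c * 2 ^ la) * (upper c * 2 ^ lb)))) (allFin n)
      ≤⟨ sumBy-mono (allFin n) (λ c → *-monoʳ-≤ (𝟙 (Q c)) (*-monoʳ-≤ (2 ^ (a + b))
           (*-mono-≤ (starHomCount-bound tournament f a a≤f (inNbhd Q c))
                     (starHomCount-bound tournament f b b≤f (outNbhd Q c))))) ⟩
        sumBy (λ c → 𝟙 (Q c) * (2 ^ (a + b) * (d⁻ Q c ^ a * d⁺ Q c ^ b))) (allFin n)
      ≤⟨ degree-product-sum-bound tournament Q a b (half-split-cases k) ⟩
        ∣ Q ∣ ^ suc (a + b)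
      ≡⟨ cong (λ m → ∣ Q ∣ ^ suc m) (half-split k) ⟩
        ∣ Q ∣ ^ suc k ∎
      where
      open ≤-Reasoning
      a = k / 2
      b = k ∸ a
      la = length (starEdges f a 0)
      lb = length (starEdges f b 0)
      a≤f : a ≤ f
      a≤f = ≤-trans (m/n≤m k 2) k≤f
      b≤f : b ≤ f
      b≤f = ≤-trans (m∸n≤m k a) k≤f
      lower upper : Fin n → ℕ
      lower c = starHomCount f a (inNbhd Q c)
      upper c = starHomCount f b (outNbhd Q c)
      split-power : 2 ^ (a + (b + (la + lb))) ≡ 2 ^ (a + b) * (2 ^ la * 2 ^ lb)
      split-power = trans (cong (2 ^_) (sym (+-assoc a b (la + lb))))
                    (trans (^-distribˡ-+-* 2 (a + b) (la + lb)) (cong (2 ^ (a + b) *_) (^-distribˡ-+-* 2 la lb)))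
      regroup : ∀ q x y p u v → q * (x * y) * (p * (u * v)) ≡ q * (p * ((x * u) * (y * v)))
      regroup = solve-∀

-- Comparison with homCount and edgeCount

allPairs : (j : ℕ) → List (Fin j × Fin j)
allPairs j = concatMap (λ x → map (λ y → x , y) (allFin j)) (allFin j)

sumBy-allPairs : ∀ j (F : Fin j × Fin j → ℕ) →
                 sumBy F (allPairs j) ≡ sumBy (λ x → sumBy (λ y → F (x , y)) (allFin j)) (allFin j)
sumBy-allPairs j F = trans (sumBy-concatMap F _ (allFin j))
                           (sumBy-cong (allFin j) (λ x → sumBy-map F (x ,_) (allFin j)))

count-toℕ≡≤1 : ∀ j m → sumBy (λ x → 𝟙 (m ≡ᵇ toℕ x)) (allFin j) ≤ 1
count-toℕ≡≤1 zero    m = z≤n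
count-toℕ≡≤1 (suc j) m = subst (_≤ 1) (sym (sumBy-allFin-suc {j} (λ x → 𝟙 (m ≡ᵇ toℕ x)))) (split m)
  where
  split : ∀ m → 𝟙 (m ≡ᵇ 0) + sumBy (λ x → 𝟙 (m ≡ᵇ suc (toℕ x))) (allFin j) ≤ 1
  split zero    = s≤s (≤-reflexive (sumBy-0 (allFin j)))
  split (suc m) = count-toℕ≡≤1 j m

count-memPair≤length : ∀ j E →
  sumBy (λ xy → 𝟙 (memPair (toℕ (proj₁ xy)) (toℕ (proj₂ xy)) E)) (allPairs j) ≤ length E
count-memPair≤length j []      = ≤-reflexive (sumBy-0 (allPairs j))
count-memPair≤length j (e ∷ E) =
  ≤-trans (sumBy-mono (allPairs j) (λ xy → 𝟙-∨ (matches xy) _))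
  (≤-trans (≤-reflexive (sumBy-+ _ _ (allPairs j))) (+-mono-≤ single (count-memPair≤length j E)))
  where
  matches : Fin j × Fin j → Bool
  matches xy = (proj₁ e ≡ᵇ toℕ (proj₁ xy)) ∧ (proj₂ e ≡ᵇ toℕ (proj₂ xy))
  single : sumBy (𝟙 ∘ matches) (allPairs j) ≤ 1
  single = begin
      sumBy (𝟙 ∘ matches) (allPairs j)
    ≡⟨ sumBy-allPairs j (𝟙 ∘ matches) ⟩
      sumBy (λ x → sumBy (λ y → 𝟙 (matches (x , y))) (allFin j)) (allFin j)
    ≡⟨ sumBy-cong (allFin j) (λ x → sumBy-cong (allFin j) (λ y → 𝟙-∧ (proj₁ e ≡ᵇ toℕ x) (proj₂ e ≡ᵇ toℕ y))) ⟩
      sumBy (λ x → sumBy (λ y → 𝟙 (proj₁ e ≡ᵇ toℕ x) * 𝟙 (proj₂ e ≡ᵇ toℕ y)) (allFin j)) (allFin j)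
    ≡⟨ sumBy-*-sumBy (λ x → 𝟙 (proj₁ e ≡ᵇ toℕ x)) (λ y → 𝟙 (proj₂ e ≡ᵇ toℕ y)) (allFin j) (allFin j) ⟩
      sumBy (λ x → 𝟙 (proj₁ e ≡ᵇ toℕ x)) (allFin j) * sumBy (λ y → 𝟙 (proj₂ e ≡ᵇ toℕ y)) (allFin j)
    ≤⟨ *-mono-≤ (count-toℕ≡≤1 j (proj₁ e)) (count-toℕ≡≤1 j (proj₂ e)) ⟩
      1 ∎
    where open ≤-Reasoning

edgeCount-S≤length : ∀ j → edgeCount (S j) ≤ length (starEdges j j 0)
edgeCount-S≤length j =
  ≤-trans (≤-reflexive (countB≡sumBy-𝟙 _ (allPairs j))) (count-memPair≤length j (starEdges j j 0))

isHom-edge : ∀ D {n} (Tr : Fin n → Fin n → Bool) (φ : Vec (Fin n) (v D)) → T (isHom D Tr φ) →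
             ∀ x y → T (adj D x y) → T (Tr (lookup φ x) (lookup φ y))
isHom-edge D Tr φ hom x y xy
  with adj D x y | All.lookup (all⁺ _ _ (All.lookup (all⁺ _ _ hom) (∈-allFin x))) (∈-allFin y)
... | true | edge-ok = edge-ok

memPair-∈ : ∀ {e} E → e ∈ E → T (memPair (proj₁ e) (proj₂ e) E)
memPair-∈ {x , y} E e∈E =
  any⁺ _ (Any.map (λ { refl → Equivalence.from T-∧ (≡⇒≡ᵇ x x refl , ≡⇒≡ᵇ y y refl) }) e∈E)

isHom-S⇒respects : ∀ {n} (Tr : Fin n → Fin n → Bool) default j (φ : Vec (Fin n) j) →
                   T (isHom (S j) Tr φ) → T (Respects Tr (valueAt default φ) (starEdges j j 0))
isHom-S⇒respects Tr default j φ hom = all⁻ _ (All.tabulate edge-respected)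
  where
  E = starEdges j j 0
  lookup-fromℕ< : ∀ {i} (i<j : i < j) → lookup φ (fromℕ< i<j) ≡ valueAt default φ i
  lookup-fromℕ< i<j = trans (sym (valueAt-lookup default φ _)) (cong (valueAt default φ) (toℕ-fromℕ< i<j))
  edge-respected : ∀ {e} → e ∈ E → T (Tr (valueAt default φ (proj₁ e)) (valueAt default φ (proj₂ e)))
  edge-respected {x , y} e∈E with x<j , y<j ← All.lookup (starEdges-bounded j j) e∈E =
    subst₂ (λ s t → T (Tr s t)) (lookup-fromℕ< x<j) (lookup-fromℕ< y<j)
      (isHom-edge (S j) Tr φ hom (fromℕ< x<j) (fromℕ< y<j)
        (subst₂ (λ s t → T (memPair s t E)) (sym (toℕ-fromℕ< x<j)) (sym (toℕ-fromℕ< y<j)) (memPair-∈ E e∈E)))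

homCount-S≤starHomCount : ∀ {n} (Tr : Fin n → Fin n → Bool) default j →
                          homCount (S j) n Tr ≤ starHomCount Tr default j j (λ _ → true)
homCount-S≤starHomCount {n} Tr default j =
  ≤-trans (≤-reflexive (countB≡sumBy-𝟙 _ (allMaps j n))) (sumBy-mono (allMaps j n) (λ φ → 𝟙-mono (λ hom →
    Equivalence.from T-∧ (all⁻ _ (All.universal _ (toList φ)) , isHom-S⇒respects Tr default j φ hom))))

∣full∣≡n : ∀ n → ∣ (λ (_ : Fin n) → true) ∣ ≡ n
∣full∣≡n n = trans (sumBy-1 (allFin n)) (length-tabulate {n = n} (λ x → x))

lemma3p9 : ∀ (k : ℕ) → AntiSidorenko (S (suc k))
lemma3p9 k zero    Tr () tournament
lemma3p9 k (suc n) Tr _  tournament = begin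
    homCount (S j) (suc n) Tr * 2 ^ edgeCount (S j)
  ≤⟨ *-mono-≤ (homCount-S≤starHomCount Tr fzero j) (^-monoʳ-≤ 2 (edgeCount-S≤length j)) ⟩
    starHomCount Tr fzero j j full * 2 ^ length (starEdges j j 0)
  ≤⟨ starHomCount-bound Tr fzero tournament j j ≤-refl full ⟩
    ∣ full ∣ ^ j
  ≡⟨ cong (_^ j) (∣full∣≡n (suc n)) ⟩
    suc n ^ j ∎
  where
  open ≤-Reasoning
  j = suc k
  full : Fin (suc n) → Bool
  full _ = true
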